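{- It is possible to save at least $k$ vertices in \textsc{Temporal Firefighter} on $((G, \lambda), r)$ if and only if it is possible to save at least $k$ vertices in \textsc{Temporal Firefighter Reserve} on $((G, \lambda), r)$.
   Context: A temporal graph is a pair $(G,\lambda)$ with $G=(V,E)$ a static graph and $\lambda: E \to 2^{\mathbb{N}}$ assigning to each edge the set of timesteps at which it is active. In \textsc{Temporal Firefighter} on a rooted temporal graph $((G,\lambda),r)$, the root burns at time $0$; at each time $t\geq 1$ one vertex that is neither burning nor already defended is defended, and then the fire spreads from each burning vertex to every undefended vertex joined to it by an edge $e$ with $t\in\lambda(e)$; a vertex is saved if it is not burning when the process ends. \textsc{Temporal Firefighter Reserve} is the same process except that no defence is required each timestep: a budget is incremented by $1$ every timestep, and on any timestep any number of valid vertices up to the current budget may be defended simultaneously, with the budget decreased by the number defended. -}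

module Defs where

open import Data.Nat using (ℕ; zero; suc; _≤_; _<_; _+_)
open import Data.Bool using (Bool; true; false; _∧_; _∨_; not)
open import Data.Fin using (Fin)
import Data.Fin as F
open import Data.Fin.Subset using (Subset; ⁅_⁆; _∪_; _∩_; ∣_∣; ∁)
import Data.Fin.Subset as S
open import Data.Vec using (tabulate; lookup)
open import Data.Product using (_×_; _,_; proj₁; proj₂; ∃)
open import Data.Sum using (_⊎_)
open import Relation.Binary.PropositionalEquality using (_≡_)

-- A temporal graph on vertex set Fin n with finite lifetime.
-- adj is the (simple, undirected) static graph G; active u v t means
-- t ∈ λ(uv).  All labels lie in {1,…,lifetime}.
record TemporalGraph (n : ℕ) : Set where
  field
    adj         : Fin n → Fin n → Bool
    adj-sym     : ∀ u v → adj u v ≡ adj v u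
    adj-irrefl  : ∀ v → adj v v ≡ false
    lifetime    : ℕ
    active      : Fin n → Fin n → ℕ → Bool
    active-sym  : ∀ u v t → active u v t ≡ active v u t
    active-edge : ∀ u v t → active u v t ≡ true → adj u v ≡ true
    active-pos  : ∀ u v t → active u v t ≡ true → 1 ≤ t
    active-life : ∀ u v t → active u v t ≡ true → t ≤ lifetime

open TemporalGraph public

anyFin : ∀ {n} → (Fin n → Bool) → Bool
anyFin {zero}  f = false
anyFin {suc n} f = f F.zero ∨ anyFin (λ i → f (F.suc i))

-- A defence schedule: the set of vertices defended at timestep t (t ≥ 1).
Schedule : ℕ → Set
Schedule n = ℕ → Subset n

module _ {n : ℕ} (G : TemporalGraph n) (r : Fin n) (σ : Schedule n) where

  -- vertices newly reached by fire at timestep t, given burning set B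
  -- (at end of step t-1) and defended set D (including step t defences)
  spread : Subset n → Subset n → ℕ → Subset n
  spread B D t = tabulate λ v →
    not (lookup D v) ∧ anyFin (λ u → lookup B u ∧ adj G u v ∧ active G u v t)

  state : ℕ → Subset n × Subset n
  state zero    = ⁅ r ⁆ , S.⊥
  state (suc t) =
    let B  = proj₁ (state t)
        D' = proj₂ (state t) ∪ σ (suc t)
    in (B ∪ spread B D' (suc t)) , D'

  burning : ℕ → Subset n
  burning t = proj₁ (state t)

  defended : ℕ → Subset n
  defended t = proj₂ (state t)

  validAt : ℕ → Set
  validAt t = σ (suc t) ∩ (burning t ∪ defended t) ≡ S.⊥

  saved : ℕ
  saved = ∣ ∁ (burning (lifetime G)) ∣

  usedUpTo : ℕ → ℕ
  usedUpTo zero    = 0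
  usedUpTo (suc t) = usedUpTo t + ∣ σ (suc t) ∣

  -- Temporal Firefighter: at each timestep t = suc s (1 ≤ t ≤ lifetime)
  -- exactly one valid vertex is defended (if no valid vertex exists,
  -- none can be defended).
  IsTFStrategy : Set
  IsTFStrategy = ∀ s → suc s ≤ lifetime G →
    validAt s ×
    (∣ σ (suc s) ∣ ≡ 1 ⊎ (∣ σ (suc s) ∣ ≡ 0 × burning s ∪ defended s ≡ S.⊤))

  -- Temporal Firefighter Reserve: budget +1 per timestep; at step t
  -- any number up to the current budget may be defended, i.e. the
  -- total defended in steps 1..t is at most t.
  IsTFRStrategy : Set
  IsTFRStrategy = ∀ s → suc s ≤ lifetime G →
    validAt s × usedUpTo (suc s) ≤ suc s

CanSaveTF : ∀ {n} → TemporalGraph n → Fin n → ℕ → Set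
CanSaveTF G r k = ∃ λ σ → IsTFStrategy G r σ × k ≤ saved G r σ

CanSaveTFR : ∀ {n} → TemporalGraph n → Fin n → ℕ → Set
CanSaveTFR G r k = ∃ λ σ → IsTFRStrategy G r σ × k ≤ saved G r σ

{-# OPTIONS --safe #-}
module Submission where

-- A Temporal Firefighter strategy defends at most t vertices in its first t steps, so
-- it is a Reserve strategy. Conversely, list the defences of a Reserve strategy in
-- chronological order. As it defends at most t vertices in its first t steps, the i-th
-- listed vertex is defended at some step τ > i, hence is not burning at time i. Let the
-- Temporal Firefighter defend the i-th listed vertex at step i + 1, or any free vertex if
-- that one is already defended. By induction on t, its fire at time t is contained in the
-- Reserve fire and it has defended every vertex the Reserve strategy defended by time t,
-- so it saves at least as many vertices.

open import Defs
open import Data.Nat using (ℕ; zero; suc; _+_; _≤_; _<_; _≤′_; ≤′-refl; ≤′-step; z≤n; s≤s)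
open import Data.Nat.Properties
  using (≤-refl; ≤-reflexive; ≤-trans; ≤-pred; <⇒≤; ≤⇒≤′; m≤n⇒m≤1+n; m≤n⇒m<n∨m≡n; +-mono-≤; +-comm)
open import Data.Bool using (Bool; true; false; _∧_; _∨_; not)
open import Data.Bool.Properties using (∨-zeroʳ)
open import Data.Fin using (Fin)
import Data.Fin as F
open import Data.Fin.Subset using (Subset; inside; outside; ⁅_⁆; _∪_; _∩_; ∣_∣; ∁; ⊥; ⊤; _∈_; _∉_; _⊆_)
open import Data.Fin.Subset.Properties
  using (∉⊥; ⊆⊤; ⊆-antisym; x∈⁅x⁆; x∈⁅y⁆⇒x≡y; ∣⁅x⁆∣≡1; ∣⊥∣≡0; p⊆p∪q; q⊆p∪q; x∈p∪q⁻;
         x∈p∩q⁺; x∈p∩q⁻; Empty-unique; nonempty?; _∈?_; x∈∁p⇒x∉p; x∉∁p⇒x∈p;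
         p⊆q⇒∁p⊇∁q; p⊆q⇒∣p∣≤∣q∣)
open import Data.Vec using ([]; _∷_; here; there; lookup)
open import Data.Vec.Properties using (lookup∘tabulate; []=⇒lookup; lookup⇒[]=)
open import Data.List using (List; []; _∷_; _++_; length; map)
open import Data.List.Properties using (length-++; length-map)
import Data.List.Relation.Unary.Any as Any
open import Data.List.Membership.Propositional using () renaming (_∈_ to _∈ₗ_)
open import Data.List.Membership.Propositional.Properties using (∈-map⁺; ∈-map⁻)
open import Data.Maybe using (Maybe; just; nothing)
open import Data.Product using (_×_; _,_; proj₁; proj₂; ∃)
import Data.Product as Product
open import Data.Sum using (_⊎_; inj₁; inj₂; [_,_])
open import Function using (id; _∘_)
open import Function.Bundles using (_⇔_; mk⇔)
open import Relation.Nullary using (yes; no; contradiction)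
open import Relation.Binary.PropositionalEquality
  using (_≡_; refl; sym; trans; cong; cong₂; subst; module ≡-Reasoning)

private
  variable
    n : ℕ

∧-true⁻ : ∀ {a b} → a ∧ b ≡ true → a ≡ true × b ≡ true
∧-true⁻ {true} b≡true = refl , b≡true

∉⇒lookup≡false : ∀ {p : Subset n} {x} → x ∉ p → lookup p x ≡ false
∉⇒lookup≡false {p = p} {x} x∉p with lookup p x in eq
... | true  = contradiction (lookup⇒[]= x p eq) x∉p
... | false = refl

not-lookup⇒∉ : ∀ {p : Subset n} {x} → not (lookup p x) ≡ true → x ∉ p
not-lookup⇒∉ e x∈p with trans (cong not (sym ([]=⇒lookup x∈p))) e
... | ()

disjoint⇒∩≡⊥ : ∀ {p q : Subset n} → (∀ {x} → x ∈ p → x ∉ q) → p ∩ q ≡ ⊥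
disjoint⇒∩≡⊥ {p = p} {q} disjoint =
  Empty-unique λ (x , x∈p∩q) → let (x∈p , x∈q) = x∈p∩q⁻ p q x∈p∩q in disjoint x∈p x∈q

∩≡⊥⇒disjoint : ∀ {p q : Subset n} {x} → p ∩ q ≡ ⊥ → x ∈ p → x ∉ q
∩≡⊥⇒disjoint p∩q≡⊥ x∈p x∈q = ∉⊥ (subst (_ ∈_) p∩q≡⊥ (x∈p∩q⁺ (x∈p , x∈q)))

anyFin⁺ : (f : Fin n → Bool) (u : Fin n) → f u ≡ true → anyFin f ≡ true
anyFin⁺ f F.zero    fu = cong (_∨ anyFin (f ∘ F.suc)) fu
anyFin⁺ f (F.suc u) fu = trans (cong (f F.zero ∨_) (anyFin⁺ (f ∘ F.suc) u fu)) (∨-zeroʳ (f F.zero))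

anyFin⁻ : (f : Fin n → Bool) → anyFin f ≡ true → ∃ λ u → f u ≡ true
anyFin⁻ {suc n} f e with f F.zero in f0
... | true  = F.zero , f0
... | false = Product.map F.suc id (anyFin⁻ (f ∘ F.suc) e)

module _ {G : TemporalGraph n} {r : Fin n} {σ : Schedule n} {B D : Subset n} {t : ℕ} {x : Fin n} where

  lookup-spread : lookup (spread G r σ B D t) x
                ≡ not (lookup D x) ∧ anyFin (λ u → lookup B u ∧ adj G u x ∧ active G u x t)
  lookup-spread = lookup∘tabulate
    (λ v → not (lookup D v) ∧ anyFin (λ u → lookup B u ∧ adj G u v ∧ active G u v t)) x

  ∈-spread⁻ : x ∈ spread G r σ B D t →
              x ∉ D × ∃ λ u → u ∈ B × adj G u x ∧ active G u x t ≡ true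
  ∈-spread⁻ x∈ with ∧-true⁻ (trans (sym lookup-spread) ([]=⇒lookup x∈))
  ... | x∉D , ignited with anyFin⁻ _ ignited
  ... | u , e with ∧-true⁻ e
  ... | u∈B , edge = not-lookup⇒∉ x∉D , u , lookup⇒[]= u B u∈B , edge

  ∈-spread⁺ : ∀ {u} → x ∉ D → u ∈ B → adj G u x ∧ active G u x t ≡ true → x ∈ spread G r σ B D t
  ∈-spread⁺ {u} x∉D u∈B edge = lookup⇒[]= x (spread G r σ B D t) (begin
    lookup (spread G r σ B D t) x
      ≡⟨ lookup-spread ⟩
    not (lookup D x) ∧ anyFin (λ u → lookup B u ∧ adj G u x ∧ active G u x t)
      ≡⟨ cong₂ (λ a b → not a ∧ b) (∉⇒lookup≡false x∉D) (anyFin⁺ _ u u-ignites) ⟩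
    true
      ∎)
    where
    open ≡-Reasoning
    u-ignites : lookup B u ∧ adj G u x ∧ active G u x t ≡ true
    u-ignites = trans (cong (_∧ _) ([]=⇒lookup u∈B)) edge

spread-mono : ∀ (G : TemporalGraph n) r σ σ′ t {B B′ D D′} →
              B ⊆ B′ → D′ ⊆ D → spread G r σ B D t ⊆ spread G r σ′ B′ D′ t
spread-mono G r σ σ′ t {B} {B′} {D} {D′} B⊆B′ D′⊆D x∈
  with ∈-spread⁻ {G = G} {r} {σ} {B} {D} {t} x∈
... | x∉D , u , u∈B , edge = ∈-spread⁺ {G = G} {r} {σ′} {B′} {D′} {t} (x∉D ∘ D′⊆D) (B⊆B′ u∈B) edge

LegalTFMove : Subset n → Subset n → Set
LegalTFMove blocked X = X ∩ blocked ≡ ⊥ × (∣ X ∣ ≡ 1 ⊎ (∣ X ∣ ≡ 0 × blocked ≡ ⊤))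

legalTFMove⇒∣X∣≤1 : ∀ {blocked X : Subset n} → LegalTFMove blocked X → ∣ X ∣ ≤ 1
legalTFMove⇒∣X∣≤1 (_ , inj₁ ∣X∣≡1)       = ≤-reflexive ∣X∣≡1
legalTFMove⇒∣X∣≤1 (_ , inj₂ (∣X∣≡0 , _)) = subst (_≤ 1) (sym ∣X∣≡0) z≤n

⁅x⁆-legal : ∀ {blocked : Subset n} {x} → x ∉ blocked → LegalTFMove blocked ⁅ x ⁆
⁅x⁆-legal {blocked = blocked} {x} x∉blocked =
  disjoint⇒∩≡⊥ (λ y∈⁅x⁆ → subst (_∉ blocked) (sym (x∈⁅y⁆⇒x≡y x y∈⁅x⁆)) x∉blocked) ,
  inj₁ (∣⁅x⁆∣≡1 x)

anyOutside : Subset n → Subset n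
anyOutside p with nonempty? (∁ p)
... | yes (x , _) = ⁅ x ⁆
... | no  _       = ⊥

anyOutside-legal : (blocked : Subset n) → LegalTFMove blocked (anyOutside blocked)
anyOutside-legal {n} blocked with nonempty? (∁ blocked)
... | yes (x , x∈∁blocked) = ⁅x⁆-legal (x∈∁p⇒x∉p x∈∁blocked)
... | no  ∁blocked-empty   = disjoint⇒∩≡⊥ (λ x∈⊥ → contradiction x∈⊥ ∉⊥) ,
                              inj₂ (∣⊥∣≡0 n , ⊆-antisym ⊆⊤ ⊤⊆blocked)
  where
  ⊤⊆blocked : ⊤ ⊆ blocked
  ⊤⊆blocked {x} _ = x∉∁p⇒x∈p (λ x∈∁blocked → ∁blocked-empty (x , x∈∁blocked))

defendPreferring : Maybe (Fin n) → Subset n → Subset n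
defendPreferring (just x) blocked with x ∈? blocked
... | no  _ = ⁅ x ⁆
... | yes _ = anyOutside blocked
defendPreferring nothing blocked = anyOutside blocked

defendPreferring-legal : ∀ m (blocked : Subset n) →
                         LegalTFMove blocked (defendPreferring m blocked)
defendPreferring-legal (just x) blocked with x ∈? blocked
... | no  x∉blocked = ⁅x⁆-legal x∉blocked
... | yes _         = anyOutside-legal blocked
defendPreferring-legal nothing blocked = anyOutside-legal blocked

defendPreferring-chooses : ∀ {blocked : Subset n} {x} →
                           x ∉ blocked → x ∈ defendPreferring (just x) blocked
defendPreferring-chooses {blocked = blocked} {x} x∉blocked with x ∈? blocked
... | no  _         = x∈⁅x⁆ x
... | yes x∈blocked = contradiction x∈blocked x∉blocked

module _ (G : TemporalGraph n) (r : Fin n) (σ : Schedule n) where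

  burning-mono : ∀ {s t} → s ≤′ t → burning G r σ s ⊆ burning G r σ t
  burning-mono ≤′-refl        = id
  burning-mono (≤′-step s≤′t) = p⊆p∪q _ ∘ burning-mono s≤′t

  defended-origin : ∀ t {v} → v ∈ defended G r σ t → ∃ λ τ → τ < t × v ∈ σ (suc τ)
  defended-origin zero    v∈⊥ = contradiction v∈⊥ ∉⊥
  defended-origin (suc t) v∈D with x∈p∪q⁻ (defended G r σ t) (σ (suc t)) v∈D
  ... | inj₁ v∈D′ = Product.map₂ (Product.map₁ m≤n⇒m≤1+n) (defended-origin t v∈D′)
  ... | inj₂ v∈σ  = t , ≤-refl , v∈σ

  validAt⇒unburnt : ∀ {s v} → validAt G r σ s → v ∈ σ (suc s) → v ∉ burning G r σ s
  validAt⇒unburnt valid v∈σ = ∩≡⊥⇒disjoint valid v∈σ ∘ p⊆p∪q _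

  usedUpTo≤ : (∀ s → suc s ≤ lifetime G → ∣ σ (suc s) ∣ ≤ 1) →
              ∀ t → t ≤ lifetime G → usedUpTo G r σ t ≤ t
  usedUpTo≤ one zero    _   = z≤n
  usedUpTo≤ one (suc t) t<L = subst (usedUpTo G r σ (suc t) ≤_) (+-comm t 1)
    (+-mono-≤ (usedUpTo≤ one t (<⇒≤ t<L)) (one t t<L))

module _ {A : Set} where

  nth : List A → ℕ → Maybe A
  nth []       _       = nothing
  nth (x ∷ xs) zero    = just x
  nth (x ∷ xs) (suc i) = nth xs i

  nth⇒< : ∀ xs {i x} → nth xs i ≡ just x → i < length xs
  nth⇒< (y ∷ xs) {zero}  _ = s≤s z≤n
  nth⇒< (y ∷ xs) {suc i} e = s≤s (nth⇒< xs e)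

  ∈⇒nth : ∀ {xs x} → x ∈ₗ xs → ∃ λ i → nth xs i ≡ just x
  ∈⇒nth (Any.here refl)  = zero , refl
  ∈⇒nth (Any.there x∈xs) with ∈⇒nth x∈xs
  ... | i , e = suc i , e

  nth⇒∈ : ∀ xs {i x} → nth xs i ≡ just x → x ∈ₗ xs
  nth⇒∈ (y ∷ xs) {zero}  refl = Any.here refl
  nth⇒∈ (y ∷ xs) {suc i} e    = Any.there (nth⇒∈ xs e)

  nth-++ˡ : ∀ xs ys {i x} → nth xs i ≡ just x → nth (xs ++ ys) i ≡ just x
  nth-++ˡ (y ∷ xs) ys {zero}  e = e
  nth-++ˡ (y ∷ xs) ys {suc i} e = nth-++ˡ xs ys e

  nth-++ʳ : ∀ xs ys j → nth (xs ++ ys) (length xs + j) ≡ nth ys j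
  nth-++ʳ []       ys j = refl
  nth-++ʳ (x ∷ xs) ys j = nth-++ʳ xs ys j

  nth-++⁻ : ∀ xs ys {i x} → nth (xs ++ ys) i ≡ just x → nth xs i ≡ just x ⊎ x ∈ₗ ys
  nth-++⁻ []       ys e = inj₂ (nth⇒∈ ys e)
  nth-++⁻ (y ∷ xs) ys {zero}  e = inj₁ e
  nth-++⁻ (y ∷ xs) ys {suc i} e = nth-++⁻ xs ys e

members : Subset n → List (Fin n)
members []            = []
members (inside  ∷ p) = F.zero ∷ map F.suc (members p)
members (outside ∷ p) = map F.suc (members p)

length-members : (p : Subset n) → length (members p) ≡ ∣ p ∣
length-members []            = refl
length-members (inside  ∷ p) = cong suc (trans (length-map F.suc (members p)) (length-members p))
length-members (outside ∷ p) = trans (length-map F.suc (members p)) (length-members p)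

∈⇒∈-members : ∀ {p : Subset n} {x} → x ∈ p → x ∈ₗ members p
∈⇒∈-members {p = inside  ∷ p} here        = Any.here refl
∈⇒∈-members {p = inside  ∷ p} (there x∈p) = Any.there (∈-map⁺ F.suc (∈⇒∈-members x∈p))
∈⇒∈-members {p = outside ∷ p} (there x∈p) = ∈-map⁺ F.suc (∈⇒∈-members x∈p)

∈-members⇒∈ : ∀ (p : Subset n) {x} → x ∈ₗ members p → x ∈ p
∈-members⇒∈ (inside ∷ p) (Any.here refl) = here
∈-members⇒∈ (inside ∷ p) (Any.there x∈) with ∈-map⁻ F.suc x∈
... | y , y∈ , refl = there (∈-members⇒∈ p y∈)
∈-members⇒∈ (outside ∷ p) x∈ with ∈-map⁻ F.suc x∈
... | y , y∈ , refl = there (∈-members⇒∈ p y∈)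

module _ (G : TemporalGraph n) (r : Fin n) (σ : Schedule n) where

  queue : ℕ → List (Fin n)
  queue zero    = []
  queue (suc t) = queue t ++ members (σ (suc t))

  length-queue : ∀ t → length (queue t) ≡ usedUpTo G r σ t
  length-queue zero    = refl
  length-queue (suc t) =
    trans (length-++ (queue t)) (cong₂ _+_ (length-queue t) (length-members (σ (suc t))))

  queue-prefix : ∀ {τ t i v} → τ ≤′ t → nth (queue τ) i ≡ just v → nth (queue t) i ≡ just v
  queue-prefix              ≤′-refl        e = e
  queue-prefix {t = suc t} (≤′-step τ≤′t) e = nth-++ˡ (queue t) _ (queue-prefix τ≤′t e)

  queue-complete : ∀ {τ v} → v ∈ σ (suc τ) →
                   ∃ λ i → i < usedUpTo G r σ (suc τ) × nth (queue (suc τ)) i ≡ just v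
  queue-complete {τ} {v} v∈σ with ∈⇒nth (∈⇒∈-members v∈σ)
  ... | j , e = length (queue τ) + j ,
                subst (length (queue τ) + j <_) (length-queue (suc τ))
                      (nth⇒< (queue (suc τ)) atPosition) ,
                atPosition
    where
    atPosition : nth (queue (suc τ)) (length (queue τ) + j) ≡ just v
    atPosition = trans (nth-++ʳ (queue τ) _ j) e

  queue-sound : ∀ t {i v} → nth (queue t) i ≡ just v →
                ∃ λ τ → τ < t × v ∈ σ (suc τ) × i < usedUpTo G r σ (suc τ)
  queue-sound (suc t) e with nth-++⁻ (queue t) (members (σ (suc t))) e
  ... | inj₁ e′ = Product.map₂ (Product.map₁ m≤n⇒m≤1+n) (queue-sound t e′)
  ... | inj₂ v∈ = t , ≤-refl , ∈-members⇒∈ _ v∈ ,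
                  subst (_ <_) (length-queue (suc t)) (nth⇒< (queue (suc t)) e)

Policy : ℕ → Set
Policy n = ℕ → Subset n × Subset n → Subset n

module _ (G : TemporalGraph n) (r : Fin n) (policy : Policy n) where

  -- adaptive (suc t) = policy t (state G r adaptive t) is not structurally recursive,
  -- so the state is recomputed alongside the schedule; spread ignores its schedule argument.
  private
    run : ℕ → Subset n × Subset n
    run zero    = ⁅ r ⁆ , ⊥
    run (suc t) =
      let B  = proj₁ (run t)
          D′ = proj₂ (run t) ∪ policy t (run t)
      in B ∪ spread G r (λ _ → ⊥) B D′ (suc t) , D′

  adaptive : Schedule n
  adaptive zero    = ⊥
  adaptive (suc t) = policy t (run t)

  private
    state-adaptive : ∀ t → state G r adaptive t ≡ run t
    state-adaptive zero = refl
    state-adaptive (suc t) rewrite state-adaptive t = refl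

  adaptive-suc : ∀ t → adaptive (suc t) ≡ policy t (state G r adaptive t)
  adaptive-suc t = cong (policy t) (sym (state-adaptive t))

module FromReserve (G : TemporalGraph n) (r : Fin n) (σ : Schedule n)
                   (reserve : IsTFRStrategy G r σ) where

  reserveQueue : List (Fin n)
  reserveQueue = queue G r σ (lifetime G)

  queued-unburnt : ∀ {i v} → nth reserveQueue i ≡ just v → v ∉ burning G r σ i
  queued-unburnt {i} e with queue-sound G r σ (lifetime G) e
  ... | τ , τ<L , v∈σ , i<U =
    validAt⇒unburnt G r σ valid v∈σ ∘ burning-mono G r σ (≤⇒≤′ (≤-pred (≤-trans i<U used≤)))
    where
    valid : validAt G r σ τ
    valid = proj₁ (reserve τ τ<L)
    used≤ : usedUpTo G r σ (suc τ) ≤ suc τ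
    used≤ = proj₂ (reserve τ τ<L)

  defended-queued : ∀ {t v} → t ≤ lifetime G → v ∈ defended G r σ t →
                    ∃ λ i → i < t × nth reserveQueue i ≡ just v
  defended-queued {t} t≤L v∈D with defended-origin G r σ t v∈D
  ... | τ , τ<t , v∈σ with queue-complete G r σ v∈σ
  ... | i , i<U , e =
    i , ≤-trans i<U (≤-trans (proj₂ (reserve τ (≤-trans τ<t t≤L))) τ<t) ,
    queue-prefix G r σ (≤⇒≤′ (≤-trans τ<t t≤L)) e

  policy : Policy n
  policy t (B , D) = defendPreferring (nth reserveQueue t) (B ∪ D)

  σTF : Schedule n
  σTF = adaptive G r policy

  private
    TB TD RB RD : ℕ → Subset n
    TB = burning G r σTF
    TD = defended G r σTF
    RB = burning G r σ
    RD = defended G r σ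

  isTF : IsTFStrategy G r σTF
  isTF s _ = subst (LegalTFMove (TB s ∪ TD s)) (sym (adaptive-suc G r policy s))
                   (defendPreferring-legal (nth reserveQueue s) (TB s ∪ TD s))

  Dominated : ℕ → Set
  Dominated s = TB s ⊆ RB s × (∀ {i v} → i < s → nth reserveQueue i ≡ just v → v ∈ TD s)

  next-queued-defended : ∀ {s v} → TB s ⊆ RB s → nth reserveQueue s ≡ just v → v ∈ TD (suc s)
  next-queued-defended {s} {v} TB⊆RB e with v ∈? TD s
  ... | yes v∈TD = p⊆p∪q _ v∈TD
  ... | no  v∉TD =
    q⊆p∪q (TD s) (σTF (suc s)) (subst (v ∈_) (sym (adaptive-suc G r policy s)) chosen)
    where
    v∉TB∪TD : v ∉ TB s ∪ TD s
    v∉TB∪TD = [ queued-unburnt e ∘ TB⊆RB , v∉TD ] ∘ x∈p∪q⁻ (TB s) (TD s)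
    chosen : v ∈ defendPreferring (nth reserveQueue s) (TB s ∪ TD s)
    chosen = subst (λ m → v ∈ defendPreferring m (TB s ∪ TD s)) (sym e)
                   (defendPreferring-chooses v∉TB∪TD)

  dominated : ∀ s → s ≤ lifetime G → Dominated s
  dominated zero    _   = id , λ ()
  dominated (suc s) s<L with dominated s (<⇒≤ s<L)
  ... | TB⊆RB , queued-defended = TB′⊆RB′ , queued-defended′
    where
    queued-defended′ : ∀ {i v} → i < suc s → nth reserveQueue i ≡ just v → v ∈ TD (suc s)
    queued-defended′ (s≤s i≤s) e with m≤n⇒m<n∨m≡n i≤s
    ... | inj₁ i<s  = p⊆p∪q _ (queued-defended i<s e)
    ... | inj₂ refl = next-queued-defended TB⊆RB e
    RD′⊆TD′ : RD (suc s) ⊆ TD (suc s)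
    RD′⊆TD′ v∈RD with defended-queued s<L v∈RD
    ... | i , i<1+s , e = queued-defended′ i<1+s e
    TB′⊆RB′ : TB (suc s) ⊆ RB (suc s)
    TB′⊆RB′ v∈TB′ with x∈p∪q⁻ (TB s) (spread G r σTF (TB s) (TD (suc s)) (suc s)) v∈TB′
    ... | inj₁ v∈TB     = p⊆p∪q _ (TB⊆RB v∈TB)
    ... | inj₂ v∈spread = q⊆p∪q (RB s) (spread G r σ (RB s) (RD (suc s)) (suc s))
                                 (spread-mono G r σTF σ (suc s) TB⊆RB RD′⊆TD′ v∈spread)

  saved-≤ : saved G r σ ≤ saved G r σTF
  saved-≤ = p⊆q⇒∣p∣≤∣q∣ (p⊆q⇒∁p⊇∁q (proj₁ (dominated (lifetime G) ≤-refl)))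

tf⇒tfr : ∀ {G : TemporalGraph n} {r σ} → IsTFStrategy G r σ → IsTFRStrategy G r σ
tf⇒tfr {G = G} {r} {σ} tf s s<L =
  proj₁ (tf s s<L) , usedUpTo≤ G r σ (λ s s<L → legalTFMove⇒∣X∣≤1 (tf s s<L)) (suc s) s<L

lemma15 : (n : ℕ) (G : TemporalGraph n) (r : Fin n) (k : ℕ) →
    CanSaveTF G r k ⇔ CanSaveTFR G r k
lemma15 n G r k = mk⇔
  (λ (σ , tf , k≤saved) → σ , tf⇒tfr tf , k≤saved)
  (λ (σ , tfr , k≤saved) →
     let open FromReserve G r σ tfr in σTF , isTF , ≤-trans k≤saved saved-≤)
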